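{- Let $\Sigma=(\Gamma,\sigma)$ be a signed simple graph, let $B=(\Gamma,\tau)$ be any orientation of $\Sigma$, and let $n\ge1$. The map sending an $n$-edge coloring $\gamma$ of $\Sigma$ to the vertex coloring $c(\ell_e)=\tau(v,e)\gamma(v,e)$ (for $v$ an endpoint of $e$; this is independent of the choice of endpoint) is a bijection between $n$-edge colorings of $\Sigma$ and $n$-vertex colorings of the signed graph $-\Sigma_{L(B)}$, and under it the proper edge colorings of $\Sigma$ correspond exactly to the proper vertex colorings of $-\Sigma_{L(B)}$. (Since $-\Lambda(\Sigma)$ is the switching class of $-\Sigma_{L(B)}$, this gives the correspondence between proper edge colorings of $\Sigma$ and proper vertex colorings of the negative of the line graph of $\Sigma$.)
   Context: A signed graph is $\Sigma=(\Gamma,\sigma)$ with $\Gamma$ a finite simple graph and $\sigma:E(\Gamma)\to\{+,-\}$; $-\Sigma=(\Gamma,-\sigma)$. An incidence is a pair $(v,e)$ with $v$ an endpoint of $e$. For $n\ge1$, $M_n=\{0,\pm1,\ldots,\pm k\}$ if $n=2k+1$ and $M_n=\{\pm1,\ldots,\pm k\}$ if $n=2k$. An $n$-edge coloring of $\Sigma$ is a map $\gamma$ from incidences to $M_n$ with $\gamma(v,e)=-\sigma(e)\gamma(w,e)$ for each edge $e$ with endpoints $v,w$; it is proper if $\gamma(v,e)\neq\gamma(v,f)$ for distinct edges $e,f$ sharing endpoint $v$. An $n$-vertex coloring of a signed graph $(\Gamma',\sigma')$ is a map $c:V(\Gamma')\to M_n$; it is proper if $c(x)\neq\sigma'(xy)c(y)$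 for every edge $xy$. A bidirected graph is $B=(\Gamma,\tau)$ with $\tau$ assigning $\pm$ to each incidence; $B$ is an orientation of $\Sigma$ if $\sigma(e)=-\tau(v,e)\tau(w,e)$ for every edge $e$ with endpoints $v,w$. The line graph $L(\Gamma)$ has a vertex $\ell_e$ for each edge $e$ of $\Gamma$, with $\ell_e\ell_f$ an edge iff $e,f$ share an endpoint. The bidirected line graph $L(B)$ is $L(\Gamma)$ with bidirection $\bar\tau(\ell_e,\ell_e\ell_f)=\tau(v,e)$, where $v$ is the common endpoint of $e$ and $f$. The associated signed graph $\Sigma_{L(B)}$ is $L(\Gamma)$ with sign $-\bar\tau(\ell_e,\ell_e\ell_f)\bar\tau(\ell_f,\ell_e\ell_f)=-\tau(v,e)\tau(v,f)$ on $\ell_e\ell_f$. Switching a signed graph at a vertex negates the signs of all edges at that vertex; the line graph $\Lambda(\Sigma)$ is the switching class of $\Sigma_{L(B)}$ (independent of the orientation $B$), and $-\Lambda(\Sigma)$ is the switching class of $-\Sigma_{L(B)}$. -}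

module Defs where

open import Data.Nat as ℕ using (ℕ; _/_; _%_)
open import Data.Integer as ℤ using (ℤ; ∣_∣; -_; 0ℤ)
open import Data.Integer.Properties using (∣-i∣≡∣i∣; neg-involutive)
open import Data.Fin using (Fin)
open import Data.Product using (Σ; _×_; _,_; proj₁; proj₂; swap)
open import Data.Sum using (_⊎_; inj₁; inj₂)
open import Data.Sign as Sign using (Sign; opposite)
open import Relation.Binary.PropositionalEquality
  using (_≡_; _≢_; refl; sym; trans; cong; subst)

-- The colour set M_n.
-- n = 2k+1 : M_n = {0, ±1, …, ±k};  n = 2k : M_n = {±1, …, ±k}.
-- Proof fields are irrelevant, so two colours are equal iff their values are.

record M (n : ℕ) : Set where
  constructor mkM
  field
    val    : ℤ
    .bound : ∣ val ∣ ℕ.≤ n / 2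
    .nz    : n % 2 ≡ 0 → val ≢ 0ℤ
open M public

negM : ∀ {n} → M n → M n
negM {n} (mkM x b z) =
  mkM (- x) (subst (ℕ._≤ n / 2) (sym (∣-i∣≡∣i∣ x)) b)
      (λ ev e → z ev (trans (sym (neg-involutive x)) (cong -_ e)))

_⊙_ : ∀ {n} → Sign → M n → M n
Sign.+ ⊙ c = c
Sign.- ⊙ c = negM c

record SimpleGraph : Set where
  field
    p m      : ℕ
    ends     : Fin m → Fin p × Fin p
    loopless : ∀ e → proj₁ (ends e) ≢ proj₂ (ends e)
    simple   : ∀ e f → (ends e ≡ ends f ⊎ ends e ≡ swap (ends f)) → e ≡ f

  Vertex : Set
  Vertex = Fin p

  Edge : Set
  Edge = Fin m

  _IsEndOf_ : Vertex → Edge → Set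
  v IsEndOf e = v ≡ proj₁ (ends e) ⊎ v ≡ proj₂ (ends e)

  Incidence : Set
  Incidence = Σ (Vertex × Edge) λ ve → proj₁ ve IsEndOf proj₂ ve

  inc₁ : Edge → Incidence
  inc₁ e = (proj₁ (ends e) , e) , inj₁ refl

  inc₂ : Edge → Incidence
  inc₂ e = (proj₂ (ends e) , e) , inj₂ refl

open SimpleGraph public

record SignedSimpleGraph : Set where
  field
    Γ : SimpleGraph
    σ : Edge Γ → Sign
open SignedSimpleGraph public

Bidirection : SimpleGraph → Set
Bidirection G = Incidence G → Sign

IsOrientation : (S : SignedSimpleGraph) → Bidirection (Γ S) → Set
IsOrientation S τ =
  ∀ e → σ S e ≡ opposite (τ (inc₁ (Γ S) e) Sign.* τ (inc₂ (Γ S) e))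

EdgeMap : SignedSimpleGraph → ℕ → Set
EdgeMap S n = Incidence (Γ S) → M n

IsEdgeColoring : (S : SignedSimpleGraph) (n : ℕ) → EdgeMap S n → Set
IsEdgeColoring S n γ =
  ∀ e → γ (inc₁ (Γ S) e) ≡ opposite (σ S e) ⊙ γ (inc₂ (Γ S) e)

IsProperEdgeColoring : (S : SignedSimpleGraph) (n : ℕ) → EdgeMap S n → Set
IsProperEdgeColoring S n γ =
  ∀ v e f → e ≢ f →
  (pe : _IsEndOf_ (Γ S) v e) (pf : _IsEndOf_ (Γ S) v f) →
  γ ((v , e) , pe) ≢ γ ((v , f) , pf)

record SignedGraph (V : Set) : Set₁ where
  field
    Adj  : V → V → Set
    sign : ∀ {x y} → Adj x y → Sign
open SignedGraph public

negSG : ∀ {V} → SignedGraph V → SignedGraph V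
negSG G = record { Adj = Adj G ; sign = λ a → opposite (sign G a) }

IsProperVertexColoring : ∀ {V} (G : SignedGraph V) (n : ℕ) → (V → M n) → Set
IsProperVertexColoring G n c =
  ∀ x y (a : Adj G x y) → c x ≢ sign G a ⊙ c y

-- Line graph: ℓ_e ℓ_f is an edge iff e ≠ f and e, f share an endpoint v.
-- (The witness records the common endpoint v, unique in a simple graph.)

LineAdj : (G : SimpleGraph) → Edge G → Edge G → Set
LineAdj G e f = e ≢ f × Σ (Vertex G) λ v → _IsEndOf_ G v e × _IsEndOf_ G v f

ΣLB : (G : SimpleGraph) → Bidirection G → SignedGraph (Edge G)
ΣLB G τ = record
  { Adj  = LineAdj G
  ; sign = λ { {e} {f} (_ , v , pe , pf) →
               opposite (τ ((v , e) , pe) Sign.* τ ((v , f) , pf)) }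
  }

toVertexColoring : (S : SignedSimpleGraph) (τ : Bidirection (Γ S)) (n : ℕ) →
                   EdgeMap S n → Edge (Γ S) → M n
toVertexColoring S τ n γ e = τ (inc₁ (Γ S) e) ⊙ γ (inc₁ (Γ S) e)

-- Since σ(e) = -τ(v,e)τ(w,e) and signs act involutively on colours, the edge
-- condition γ(v,e) = -σ(e)γ(w,e) says exactly that τ(v,e)γ(v,e) = τ(w,e)γ(w,e);
-- so c(ℓ_e) is well defined and γ(v,e) = τ(v,e)c(ℓ_e) inverts the map. For
-- e, f meeting at v the sign of ℓ_e ℓ_f in -Σ_{L(B)} is τ(v,e)τ(v,f), hence
-- c(ℓ_e) = τ(v,e)τ(v,f)c(ℓ_f) unfolds to τ(v,e)γ(v,e) = τ(v,e)γ(v,f), that is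
-- γ(v,e) = γ(v,f): improper pairs correspond on both sides.
module Submission where

open import Defs
open import Data.Nat using (ℕ; _≥_)
open import Data.Product using (Σ; _×_; _,_)
open import Data.Sign using (Sign; opposite; _*_)
open import Data.Sign.Properties using (opposite-involutive)
open import Data.Sum using (inj₁; inj₂)
open import Function using (_∘_; _⇔_; Equivalence; mk⇔)
open import Data.Integer.Properties using (neg-involutive)
open import Relation.Binary.PropositionalEquality
  using (_≡_; _≢_; refl; sym; trans; cong; module ≡-Reasoning)
open ≡-Reasoning

mkM-cong : ∀ {n x y} .{b b′} .{z z′} → x ≡ y → mkM {n} x b z ≡ mkM y b′ z′
mkM-cong refl = refl

negM-involutive : ∀ {n} (x : M n) → negM (negM x) ≡ x
negM-involutive (mkM x _ _) = mkM-cong (neg-involutive x)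

⊙-involutive : ∀ {n} s (x : M n) → s ⊙ (s ⊙ x) ≡ x
⊙-involutive Sign.+ x = refl
⊙-involutive Sign.- x = negM-involutive x

⊙-injective : ∀ {n} s {x y : M n} → s ⊙ x ≡ s ⊙ y → x ≡ y
⊙-injective s {x} {y} eq = begin
  x             ≡⟨ sym (⊙-involutive s x) ⟩
  s ⊙ (s ⊙ x)   ≡⟨ cong (s ⊙_) eq ⟩
  s ⊙ (s ⊙ y)   ≡⟨ ⊙-involutive s y ⟩
  y             ∎

*-⊙ : ∀ {n} s t (x : M n) → (s * t) ⊙ x ≡ s ⊙ (t ⊙ x)
*-⊙ Sign.+ t      x = refl
*-⊙ Sign.- Sign.+ x = refl
*-⊙ Sign.- Sign.- x = sym (negM-involutive x)

*-⊙-cancelʳ : ∀ {n} s t (x : M n) → (s * t) ⊙ (t ⊙ x) ≡ s ⊙ x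
*-⊙-cancelʳ s t x = trans (*-⊙ s t (t ⊙ x)) (cong (s ⊙_) (⊙-involutive t x))

⊙-*-cancelˡ : ∀ {n} s t (x : M n) → s ⊙ ((s * t) ⊙ x) ≡ t ⊙ x
⊙-*-cancelˡ s t x = trans (cong (s ⊙_) (*-⊙ s t x)) (⊙-involutive s (t ⊙ x))

module Correspondence
  (S : SignedSimpleGraph) (τ : Bidirection (Γ S)) (orientation : IsOrientation S τ)
  (n : ℕ)
  where

  G : SimpleGraph
  G = Γ S

  edgeOf : Incidence G → Edge G
  edgeOf ((_ , e) , _) = e

  opposite-σ : ∀ e → opposite (σ S e) ≡ τ (inc₁ G e) * τ (inc₂ G e)
  opposite-σ e = trans (cong opposite (orientation e)) (opposite-involutive _)

  endpoint-independent : ∀ γ → IsEdgeColoring S n γ → ∀ e →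
    τ (inc₁ G e) ⊙ γ (inc₁ G e) ≡ τ (inc₂ G e) ⊙ γ (inc₂ G e)
  endpoint-independent γ isColoring e = begin
    τ₁ ⊙ γ (inc₁ G e)                         ≡⟨ cong (τ₁ ⊙_) (isColoring e) ⟩
    τ₁ ⊙ (opposite (σ S e) ⊙ γ (inc₂ G e))    ≡⟨ cong (λ s → τ₁ ⊙ (s ⊙ γ (inc₂ G e))) (opposite-σ e) ⟩
    τ₁ ⊙ ((τ₁ * τ₂) ⊙ γ (inc₂ G e))           ≡⟨ ⊙-*-cancelˡ τ₁ τ₂ _ ⟩
    τ₂ ⊙ γ (inc₂ G e)                         ∎
    where τ₁ = τ (inc₁ G e); τ₂ = τ (inc₂ G e)

  toVertexColoring-at : ∀ γ → IsEdgeColoring S n γ → (i : Incidence G) →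
    toVertexColoring S τ n γ (edgeOf i) ≡ τ i ⊙ γ i
  toVertexColoring-at γ isColoring ((_ , e) , inj₁ refl) = refl
  toVertexColoring-at γ isColoring ((_ , e) , inj₂ refl) = endpoint-independent γ isColoring e

  toVertexColoring-injective : ∀ γ₁ γ₂ → IsEdgeColoring S n γ₁ → IsEdgeColoring S n γ₂ →
    (∀ e → toVertexColoring S τ n γ₁ e ≡ toVertexColoring S τ n γ₂ e) →
    ∀ i → γ₁ i ≡ γ₂ i
  toVertexColoring-injective γ₁ γ₂ isColoring₁ isColoring₂ sameImage i =
    ⊙-injective (τ i) (begin
      τ i ⊙ γ₁ i                            ≡⟨ sym (toVertexColoring-at γ₁ isColoring₁ i) ⟩
      toVertexColoring S τ n γ₁ (edgeOf i)  ≡⟨ sameImage (edgeOf i) ⟩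
      toVertexColoring S τ n γ₂ (edgeOf i)  ≡⟨ toVertexColoring-at γ₂ isColoring₂ i ⟩
      τ i ⊙ γ₂ i                            ∎)

  fromVertexColoring : (Edge G → M n) → EdgeMap S n
  fromVertexColoring c i = τ i ⊙ c (edgeOf i)

  fromVertexColoring-isEdgeColoring : ∀ c → IsEdgeColoring S n (fromVertexColoring c)
  fromVertexColoring-isEdgeColoring c e = sym (begin
    opposite (σ S e) ⊙ (τ₂ ⊙ c e)   ≡⟨ cong (λ s → s ⊙ (τ₂ ⊙ c e)) (opposite-σ e) ⟩
    (τ₁ * τ₂) ⊙ (τ₂ ⊙ c e)          ≡⟨ *-⊙-cancelʳ τ₁ τ₂ (c e) ⟩
    τ₁ ⊙ c e                        ∎)
    where τ₁ = τ (inc₁ G e); τ₂ = τ (inc₂ G e)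

  toVertexColoring-fromVertexColoring : ∀ c e →
    toVertexColoring S τ n (fromVertexColoring c) e ≡ c e
  toVertexColoring-fromVertexColoring c e = ⊙-involutive (τ (inc₁ G e)) (c e)

  -ΣLB : SignedGraph (Edge G)
  -ΣLB = negSG (ΣLB G τ)

  module _ (γ : EdgeMap S n) (isColoring : IsEdgeColoring S n γ)
           {v e f} (pe : _IsEndOf_ G v e) (pf : _IsEndOf_ G v f) where

    private
      i j : Incidence G
      i = (v , e) , pe
      j = (v , f) , pf
      c = toVertexColoring S τ n γ

    colour-constraint-at : (τ i * τ j) ⊙ c f ≡ τ i ⊙ γ j
    colour-constraint-at = begin
      (τ i * τ j) ⊙ c f           ≡⟨ cong ((τ i * τ j) ⊙_) (toVertexColoring-at γ isColoring j) ⟩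
      (τ i * τ j) ⊙ (τ j ⊙ γ j)   ≡⟨ *-⊙-cancelʳ (τ i) (τ j) (γ j) ⟩
      τ i ⊙ γ j                   ∎

    -ΣLB-sign : (e≢f : e ≢ f) → sign -ΣLB (e≢f , v , pe , pf) ≡ τ i * τ j
    -ΣLB-sign _ = opposite-involutive (τ i * τ j)

    constraint⇔sameColour : (e≢f : e ≢ f) →
      (c e ≡ sign -ΣLB (e≢f , v , pe , pf) ⊙ c f) ⇔ (γ i ≡ γ j)
    constraint⇔sameColour e≢f = mk⇔ to from
      where
      c[e] : c e ≡ τ i ⊙ γ i
      c[e] = toVertexColoring-at γ isColoring i

      constraint : sign -ΣLB (e≢f , v , pe , pf) ⊙ c f ≡ τ i ⊙ γ j
      constraint = trans (cong (_⊙ c f) (-ΣLB-sign e≢f)) colour-constraint-at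

      to : c e ≡ sign -ΣLB (e≢f , v , pe , pf) ⊙ c f → γ i ≡ γ j
      to eq = ⊙-injective (τ i) (trans (sym c[e]) (trans eq constraint))

      from : γ i ≡ γ j → c e ≡ sign -ΣLB (e≢f , v , pe , pf) ⊙ c f
      from eq = trans c[e] (trans (cong (τ i ⊙_) eq) (sym constraint))

  properEdge→properVertex : ∀ γ → IsEdgeColoring S n γ →
    IsProperEdgeColoring S n γ → IsProperVertexColoring -ΣLB n (toVertexColoring S τ n γ)
  properEdge→properVertex γ isColoring proper e f (e≢f , v , pe , pf) =
    proper v e f e≢f pe pf ∘ Equivalence.to (constraint⇔sameColour γ isColoring pe pf e≢f)

  properVertex→properEdge : ∀ γ → IsEdgeColoring S n γ →
    IsProperVertexColoring -ΣLB n (toVertexColoring S τ n γ) → IsProperEdgeColoring S n γ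
  properVertex→properEdge γ isColoring proper v e f e≢f pe pf =
    proper e f (e≢f , v , pe , pf) ∘ Equivalence.from (constraint⇔sameColour γ isColoring pe pf e≢f)

-- The hypothesis n ≥ 1 is unused: the correspondence holds for every n.
mainTheorem5 : (S : SignedSimpleGraph) (τ : Bidirection (Γ S)) → IsOrientation S τ →
    (n : ℕ) → n ≥ 1 →
    -- independence of the endpoint: τ(v,e)γ(v,e) = τ(w,e)γ(w,e)
    (∀ (γ : EdgeMap S n) → IsEdgeColoring S n γ → ∀ e →
        τ (inc₁ (Γ S) e) ⊙ γ (inc₁ (Γ S) e)
          ≡ τ (inc₂ (Γ S) e) ⊙ γ (inc₂ (Γ S) e))
    -- injective on edge colourings (up to pointwise equality)
    × (∀ (γ₁ γ₂ : EdgeMap S n) → IsEdgeColoring S n γ₁ → IsEdgeColoring S n γ₂ →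
        (∀ e → toVertexColoring S τ n γ₁ e ≡ toVertexColoring S τ n γ₂ e) →
        ∀ i → γ₁ i ≡ γ₂ i)
    -- surjective onto n-vertex colourings of the line graph
    × (∀ (c : Edge (Γ S) → M n) →
        Σ (EdgeMap S n) λ γ → IsEdgeColoring S n γ ×
          (∀ e → toVertexColoring S τ n γ e ≡ c e))
    -- proper edge colourings ↔ proper vertex colourings of -Σ_{L(B)}
    × (∀ (γ : EdgeMap S n) → IsEdgeColoring S n γ →
        (IsProperEdgeColoring S n γ →
           IsProperVertexColoring (negSG (ΣLB (Γ S) τ)) n (toVertexColoring S τ n γ))
        × (IsProperVertexColoring (negSG (ΣLB (Γ S) τ)) n (toVertexColoring S τ n γ) →
           IsProperEdgeColoring S n γ))
mainTheorem5 S τ orientation n _ =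
    endpoint-independent
  , toVertexColoring-injective
  , (λ c → fromVertexColoring c
         , fromVertexColoring-isEdgeColoring c
         , toVertexColoring-fromVertexColoring c)
  , λ γ isColoring → properEdge→properVertex γ isColoring
                   , properVertex→properEdge γ isColoring
  where open Correspondence S τ orientation n
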